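{- Let $s,r,t$ be positive integers and let $T=\sum_{k=0}^{s}\binom{r}{k}$. Let $\mathcal{F}=(V,E)$ be an $r$-uniform hypergraph. Then there exist $E^*\subset E$ with $|E^*|\ge(tr2^{2r+1})^{ -T-1}|E|$ and a map $c:V\to[r]$ such that: (i) $c(F)=[r]$ for all $F\in E^*$; (ii) there is a hypergraph $\mathcal{H}$ on vertex set $[r]$, all of whose edges have size at most $s$, such that for every $e\subseteq[r]$ with $|e|\le s$: if $e\in E(\mathcal{H})$, then for every $F\in E^*$ there are distinct $F_1,\dots,F_t\in E^*$ with $c(F\cap F_i)\supseteq e$ for each $i\in[t]$; and if $e\notin E(\mathcal{H})$, then for all distinct $F,F'\in E^*$ we have $c(F\cap F')\not\supseteq e$.
   Context: A hypergraph $\mathcal{F}=(V,E)$ has edge set $E$ consisting of subsets of $V$; it is $r$-uniform if every edge has exactly $r$ elements. $[r]=\{1,\dots,r\}$, and for $S\subseteq V$, $c(S)=\{c(v):v\in S\}$. -}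

module Defs where

open import Data.Nat using (ℕ; zero; suc; _+_; _*_; _^_; _≤_)
open import Data.Nat.Combinatorics using (_C_)
open import Data.Fin using (Fin)
open import Data.Fin.Subset using (Subset; ∣_∣) renaming (_∈_ to _∈ₛ_)
open import Data.List using (List; length)
open import Data.List.Membership.Propositional using (_∈_)
open import Data.List.Relation.Unary.All using (All)
open import Data.List.Relation.Unary.Unique.Propositional using (Unique)
open import Data.Product using (Σ; _×_; ∃)
open import Data.Bool using (Bool; true)
open import Relation.Binary.PropositionalEquality using (_≡_; _≢_)
open import Function.Definitions using (Injective)

binomSum : ℕ → ℕ → ℕ
binomSum r zero    = r C 0
binomSum r (suc s) = binomSum r s + r C (suc s)

record UniformHypergraph (n r : ℕ) : Set where
  field
    edges     : List (Subset n)
    unique    : Unique edges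
    uniform   : All (λ F → ∣ F ∣ ≡ r) edges

_∈img_under_ : ∀ {n r} → Fin r → Subset n → (Fin n → Fin r) → Set
j ∈img S under c = ∃ λ v → (v ∈ₛ S) × (c v ≡ j)

ImageIsAll : ∀ {n r} → (Fin n → Fin r) → Subset n → Set
ImageIsAll {r = r} c S = (j : Fin r) → j ∈img S under c

ImgCapContains : ∀ {n r} → (Fin n → Fin r) → Subset n → Subset n → Subset r → Set
ImgCapContains c S S' e = ∀ j → j ∈ₛ e → ∃ λ v → (v ∈ₛ S) × (v ∈ₛ S') × (c v ≡ j)

-- A hypergraph H on vertex set [r] = Fin r, given by the (decidable) characteristic
-- function of its edge set; all edges have size at most s.
HasEdgesAtMost : ∀ {r} → ℕ → (Subset r → Bool) → Set
HasEdgesAtMost s H = ∀ e → H e ≡ true → ∣ e ∣ ≤ s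

module Submission where

-- A uniformly random colouring makes an edge rainbow with probability r! / r ^ r ≥ r ^ -r. The
-- method of conditional expectations colours the vertices one at a time without letting the
-- expected number of rainbow edges drop, and so finds a colouring with at least |E| / r ^ r
-- rainbow edges.
--
-- Call rainbow edges F, G e-linked when c(F ∩ G) ⊇ e, for the T types e ⊆ [r] with |e| ≤ s.
-- Repeatedly delete an edge that is e-linked to fewer than t remaining edges, for some type e
-- still under consideration. If half the edges survive, every survivor is e-linked to t
-- survivors for each such e, and these types are the edges of H. Otherwise some type e caused a
-- 1 / T fraction of the deletions; in deletion order each of these is e-linked to fewer than t
-- later ones, so a greedy choice keeps a 1 / t fraction of them pairwise not e-linked. Then e is
-- not an edge of H, and the argument recurses on the remaining types, losing a factor 2tT per
-- round.

open import Defs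
open import Data.Nat using (ℕ; zero; suc; _+_; _*_; _^_; _≤_; _<_; z≤n; s≤s; NonZero; _!)
open import Data.Nat.Properties
open import Data.Nat.ListAction using (sum)
open import Data.Nat.ListAction.Properties using (sum-++)
open import Data.Nat.Combinatorics using (_C_; nCk+nC[k+1]≡[n+1]C[k+1]; nC1≡n)
open import Data.Nat.Tactic.RingSolver using (solve-∀)
open import Data.Fin using (Fin; zero; suc; inject≤)
open import Data.Fin.Properties using (all?; any?; inject≤-injective) renaming (_≟_ to _≟ᶠ_)
open import Data.Fin.Subset using (Subset; ∣_∣; ⊥; ⁅_⁆; _∪_; inside; outside) renaming (_∈_ to _∈ₛ_; _∉_ to _∉ₛ_)
open import Data.Fin.Subset.Properties using (_∈?_; ∉⊥; ∈⊤; ∣p∣≡n⇒p≡⊤; x∈p∪q⁻; x∈⁅y⁆⇒x≡y; ∪-identityˡ; ∣⊥∣≡0)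
open import Data.Vec using ([]; _∷_; here; there)
open import Data.List using (List; []; _∷_; [_]; _++_; length; map; filter; tabulate; lookup; concatMap)
open import Data.List.Properties using (length-++; length-map; length-tabulate; map-++; filter-++; filter-accept; filter-≐; length-filter; filter-notAll; length-++-sucʳ)
open import Data.List.Membership.Propositional using (_∈_; _∉_; find; lose)
open import Data.List.Membership.Propositional.Properties using (∈-map⁺; ∈-map⁻; ∈-tabulate⁻; ∈-++⁺ˡ; ∈-++⁺ʳ; ∈-lookup; ∈-filter⁻; ∈-filter⁺; ∈-∃++)
open import Data.List.Relation.Unary.All as All using (All; []; _∷_)
import Data.List.Relation.Unary.All.Properties as AllProperties
open import Data.List.Relation.Unary.Any using (here; there) renaming (any? to anyᴸ?)
open import Data.List.Relation.Unary.Unique.Propositional using (Unique)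
import Data.List.Relation.Unary.Unique.Propositional.Properties as Unique
open import Data.List.Relation.Unary.AllPairs using ([]; _∷_)
open import Data.List.Relation.Binary.Sublist.Propositional using (_⊆_; []; _∷_; _∷ʳ_; ⊆-refl; ⊆-trans)
import Data.List.Relation.Binary.Sublist.Propositional.Properties as Sublist
open import Data.List.Relation.Binary.Permutation.Propositional using (_↭_; ↭⇒↭ₛ; ↭-refl; ↭-sym; ↭-trans; ↭-prep)
open import Data.List.Relation.Binary.Permutation.Propositional.Properties using (↭-length; filter-↭; shift; ∈-resp-↭)
import Data.List.Relation.Binary.Permutation.Setoid.Properties as PermutationSetoid
open import Data.Product using (Σ; _×_; ∃; _,_; proj₁; proj₂)
open import Data.Sum using (_⊎_; inj₁; inj₂; [_,_]′; map₂)
open import Data.Bool using (Bool; true; if_then_else_) renaming (_≟_ to _≟ᵇ_)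
open import Data.Vec.Properties using (≡-dec)
open import Data.Empty using (⊥-elim)
open import Data.Unit using (⊤; tt)
open import Induction.WellFounded using (Acc; acc)
open import Data.Nat.Induction using (<-wellFounded)
open import Relation.Nullary using (¬_; Dec; yes; no; does; ¬?)
open import Relation.Nullary.Decidable using (_×-dec_; _⊎-dec_; _→-dec_; isYes; toWitness; fromWitness)
open import Data.Bool.Properties using (T-≡)
open import Function.Bundles using (Equivalence)
import Data.List.Membership.DecPropositional as DecMembership
open import Relation.Binary.PropositionalEquality hiding ([_])
open import Relation.Unary using (_≐_)
open import Function.Definitions using (Injective)
open import Function using (_∘_; id)
open import Data.Vec.Functional using () renaming (_∷_ to _◂_)
open import Algebra.Properties.CommutativeSemigroup +-commutativeSemigroup using (interchange; x∙yz≈y∙xz)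
open import Algebra.Properties.CommutativeSemigroup *-commutativeSemigroup using () renaming (interchange to *-interchange)

module _ {A : Set} where

  Unique-resp-↭ : ∀ {xs ys : List A} → xs ↭ ys → Unique xs → Unique ys
  Unique-resp-↭ p = PermutationSetoid.Unique-resp-↭ (setoid A) (↭⇒↭ₛ p)

  Unique-resp-⊇ : ∀ {xs ys : List A} → xs ⊆ ys → Unique ys → Unique xs
  Unique-resp-⊇ []         _        = []
  Unique-resp-⊇ (_ ∷ʳ p)   (_ ∷ u)  = Unique-resp-⊇ p u
  Unique-resp-⊇ (refl ∷ p) (x≢ ∷ u) = Sublist.All-resp-⊆ p x≢ ∷ Unique-resp-⊇ p u

  lookup-injective : ∀ {xs : List A} → Unique xs → ∀ {i j} → lookup xs i ≡ lookup xs j → i ≡ j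
  lookup-injective {_ ∷ _} _        {zero}  {zero}  _  = refl
  lookup-injective {_ ∷ _} (x≢ ∷ _) {zero}  {suc j} eq = ⊥-elim (All.lookup x≢ (∈-lookup j) eq)
  lookup-injective {_ ∷ _} (x≢ ∷ _) {suc i} {zero}  eq = ⊥-elim (All.lookup x≢ (∈-lookup i) (sym eq))
  lookup-injective {_ ∷ _} (_ ∷ u)  {suc i} {suc j} eq = cong suc (lookup-injective u eq)

  Fin-embedding : ∀ {xs : List A} {t} → Unique xs → t ≤ length xs →
                  Σ (Fin t → A) λ f → Injective _≡_ _≡_ f × (∀ i → f i ∈ xs)
  Fin-embedding {xs} u t≤ = (λ i → lookup xs (inject≤ i t≤)) ,
                            (λ eq → inject≤-injective t≤ t≤ _ _ (lookup-injective u eq)) ,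
                            (λ i → ∈-lookup (inject≤ i t≤))

count : ∀ {A : Set} {P : A → Set} → ((x : A) → Dec (P x)) → List A → ℕ
count P? xs = length (filter P? xs)

module _ {A : Set} {P : A → Set} (P? : (x : A) → Dec (P x)) where

  count-++ : ∀ xs ys → count P? (xs ++ ys) ≡ count P? xs + count P? ys
  count-++ xs ys = trans (cong length (filter-++ P? xs ys)) (length-++ (filter P? xs))

  count-map : ∀ {B : Set} (f : B → A) xs → count P? (map f xs) ≡ count (P? ∘ f) xs
  count-map f []       = refl
  count-map f (x ∷ xs) with P? (f x)
  ... | yes _ = cong suc (count-map f xs)
  ... | no  _ = count-map f xs

  count-⊆ : ∀ {xs ys} → xs ⊆ ys → count P? xs ≤ count P? ys
  count-⊆ xs⊆ys = Sublist.length-mono-≤ (Sublist.filter⁺ P? P? (subst P) xs⊆ys)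

  count-↭ : ∀ {xs ys} → xs ↭ ys → count P? xs ≡ count P? ys
  count-↭ xs↭ys = ↭-length (filter-↭ P? xs↭ys)

  count+count-∁≡length : ∀ xs → count P? xs + count (¬? ∘ P?) xs ≡ length xs
  count+count-∁≡length []       = refl
  count+count-∁≡length (x ∷ xs) with P? x
  ... | yes _ = cong suc (count+count-∁≡length xs)
  ... | no  _ = trans (+-suc _ _) (cong suc (count+count-∁≡length xs))

  count-[]-mono : ∀ {B : Set} {Q : B → Set} (Q? : (y : B) → Dec (Q y)) {x y} →
                  (P x → Q y) → count P? [ x ] ≤ count Q? [ y ]
  count-[]-mono Q? {x} {y} P⇒Q with P? x | Q? y
  ... | yes _  | yes _  = ≤-refl
  ... | yes Px | no ¬Qy = ⊥-elim (¬Qy (P⇒Q Px))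
  ... | no _   | _      = z≤n

sum-map-mono-≤ : ∀ {A : Set} {f g : A → ℕ} → (∀ x → f x ≤ g x) →
                 ∀ xs → sum (map f xs) ≤ sum (map g xs)
sum-map-mono-≤ f≤g []       = z≤n
sum-map-mono-≤ f≤g (x ∷ xs) = +-mono-≤ (f≤g x) (sum-map-mono-≤ f≤g xs)

pigeonhole : ∀ x xs → ∃ λ y → y ∈ x ∷ xs × sum (x ∷ xs) ≤ length (x ∷ xs) * y
pigeonhole x []         = x , here refl , ≤-refl
pigeonhole x (x′ ∷ xs) with pigeonhole x′ xs
... | y , y∈ , sum≤ with x ≤? y
...   | yes x≤y = y , there y∈ , +-mono-≤ x≤y sum≤
...   | no  x≰y =
  x , here refl , +-monoʳ-≤ x (≤-trans sum≤ (*-monoʳ-≤ (length (x′ ∷ xs)) (<⇒≤ (≰⇒> x≰y))))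

∑ : ∀ {m} → (Fin m → ℕ) → ℕ
∑ f = sum (tabulate f)

∑-cong : ∀ {m} {f g : Fin m → ℕ} → (∀ k → f k ≡ g k) → ∑ f ≡ ∑ g
∑-cong {zero}  f≡g = refl
∑-cong {suc m} f≡g = cong₂ _+_ (f≡g zero) (∑-cong (f≡g ∘ suc))

∑-mono-≤ : ∀ {m} {f g : Fin m → ℕ} → (∀ k → f k ≤ g k) → ∑ f ≤ ∑ g
∑-mono-≤ {zero}  f≤g = z≤n
∑-mono-≤ {suc m} f≤g = +-mono-≤ (f≤g zero) (∑-mono-≤ (f≤g ∘ suc))

∑-distrib-+ : ∀ {m} (f g : Fin m → ℕ) → ∑ (λ k → f k + g k) ≡ ∑ f + ∑ g
∑-distrib-+ {zero}  f g = refl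
∑-distrib-+ {suc m} f g = trans (cong (f zero + g zero +_) (∑-distrib-+ (f ∘ suc) (g ∘ suc)))
                                (interchange (f zero) (g zero) (∑ (f ∘ suc)) (∑ (g ∘ suc)))

∑-const : ∀ m a → ∑ {m} (λ _ → a) ≡ m * a
∑-const zero    a = refl
∑-const (suc m) a = cong (a +_) (∑-const m a)

∑-pigeonhole : ∀ {m} .{{_ : NonZero m}} (f : Fin m → ℕ) → ∃ λ k → ∑ f ≤ m * f k
∑-pigeonhole {suc m} f with pigeonhole (f zero) (tabulate (f ∘ suc))
... | y , y∈ , sum≤ with ∈-tabulate⁻ {f = f} y∈
...   | k , refl = k , subst (λ l → ∑ f ≤ l * f k) (length-tabulate f) sum≤

∑-nonmembers : ∀ {m} (A : Subset m) b → ∑ (λ k → if does (k ∈? A) then 0 else b) + ∣ A ∣ * b ≡ m * b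
∑-nonmembers []           b = refl
∑-nonmembers (inside ∷ A) b = trans (x∙yz≈y∙xz (∑ λ k → if does (k ∈? A) then 0 else b) b (∣ A ∣ * b))
                                    (cong (b +_) (∑-nonmembers A b))
∑-nonmembers (outside ∷ A) b = trans (+-assoc b _ _) (cong (b +_) (∑-nonmembers A b))

∣⁅x⁆∪p∣≡1+∣p∣ : ∀ {m} {x : Fin m} {p : Subset m} → x ∉ₛ p → ∣ ⁅ x ⁆ ∪ p ∣ ≡ suc ∣ p ∣
∣⁅x⁆∪p∣≡1+∣p∣ {x = zero}  {outside ∷ p} _   = cong (suc ∘ ∣_∣) (∪-identityˡ p)
∣⁅x⁆∪p∣≡1+∣p∣ {x = zero}  {inside ∷ p}  x∉p = ⊥-elim (x∉p here)
∣⁅x⁆∪p∣≡1+∣p∣ {x = suc x} {outside ∷ p} x∉p = ∣⁅x⁆∪p∣≡1+∣p∣ (x∉p ∘ there)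
∣⁅x⁆∪p∣≡1+∣p∣ {x = suc x} {inside ∷ p}  x∉p = cong suc (∣⁅x⁆∪p∣≡1+∣p∣ (x∉p ∘ there))

_≟ˢ_ : ∀ {m} (p q : Subset m) → Dec (p ≡ q)
_≟ˢ_ = ≡-dec _≟ᵇ_

∈img? : ∀ {n r} (c : Fin n → Fin r) (S : Subset n) (j : Fin r) → Dec (j ∈img S under c)
∈img? c S j = any? λ v → (v ∈? S) ×-dec (c v ≟ᶠ j)

imageIsAll? : ∀ {n r} (c : Fin n → Fin r) (S : Subset n) → Dec (ImageIsAll c S)
imageIsAll? c S = all? (∈img? c S)

subsetsOfSize≤ : (r s : ℕ) → List (Subset r)
subsetsOfSize≤ zero    s       = [ [] ]
subsetsOfSize≤ (suc r) zero    = map (outside ∷_) (subsetsOfSize≤ r zero)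
subsetsOfSize≤ (suc r) (suc s) =
  map (inside ∷_) (subsetsOfSize≤ r s) ++ map (outside ∷_) (subsetsOfSize≤ r (suc s))

∈-subsetsOfSize≤ : ∀ {r s} (e : Subset r) → ∣ e ∣ ≤ s → e ∈ subsetsOfSize≤ r s
∈-subsetsOfSize≤             []            _           = here refl
∈-subsetsOfSize≤ {s = zero}  (outside ∷ e) ∣e∣≤s       = ∈-map⁺ (outside ∷_) (∈-subsetsOfSize≤ e ∣e∣≤s)
∈-subsetsOfSize≤ {s = suc s} (outside ∷ e) ∣e∣≤s       =
  ∈-++⁺ʳ (map (inside ∷_) (subsetsOfSize≤ _ s)) (∈-map⁺ (outside ∷_) (∈-subsetsOfSize≤ e ∣e∣≤s))
∈-subsetsOfSize≤ {s = suc s} (inside ∷ e)  (s≤s ∣e∣≤s) =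
  ∈-++⁺ˡ (∈-map⁺ (inside ∷_) (∈-subsetsOfSize≤ e ∣e∣≤s))

binomSum-zeroˡ : ∀ s → binomSum 0 s ≡ 1
binomSum-zeroˡ zero    = refl
binomSum-zeroˡ (suc s) = trans (+-identityʳ (binomSum 0 s)) (binomSum-zeroˡ s)

binomSum-pascal : ∀ r s → binomSum (suc r) (suc s) ≡ binomSum r s + binomSum r (suc s)
binomSum-pascal r zero    = cong (1 +_) (sym (nCk+nC[k+1]≡[n+1]C[k+1] r 0))
binomSum-pascal r (suc s) = begin
  binomSum (suc r) (suc s) + suc r C suc (suc s)
    ≡⟨ cong₂ _+_ (binomSum-pascal r s) (sym (nCk+nC[k+1]≡[n+1]C[k+1] r (suc s))) ⟩
  (binomSum r s + binomSum r (suc s)) + (r C suc s + r C suc (suc s))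
    ≡⟨ interchange (binomSum r s) (binomSum r (suc s)) (r C suc s) (r C suc (suc s)) ⟩
  binomSum r (suc s) + binomSum r (suc (suc s)) ∎
  where open ≡-Reasoning

length-subsetsOfSize≤ : ∀ r s → length (subsetsOfSize≤ r s) ≡ binomSum r s
length-subsetsOfSize≤ zero    s       = sym (binomSum-zeroˡ s)
length-subsetsOfSize≤ (suc r) zero    =
  trans (length-map _ (subsetsOfSize≤ r zero)) (length-subsetsOfSize≤ r zero)
length-subsetsOfSize≤ (suc r) (suc s) = begin
  length (map (inside ∷_) xs ++ map (outside ∷_) ys)         ≡⟨ length-++ (map (inside ∷_) xs) ⟩
  length (map (inside ∷_) xs) + length (map (outside ∷_) ys) ≡⟨ cong₂ _+_ (length-map _ xs) (length-map _ ys) ⟩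
  length xs + length ys                                     ≡⟨ cong₂ _+_ (length-subsetsOfSize≤ r s) (length-subsetsOfSize≤ r (suc s)) ⟩
  binomSum r s + binomSum r (suc s)                         ≡⟨ binomSum-pascal r s ⟨
  binomSum (suc r) (suc s)                                  ∎
  where
  open ≡-Reasoning
  xs ys : List (Subset r)
  xs = subsetsOfSize≤ r s
  ys = subsetsOfSize≤ r (suc s)

binomSum≤2^ : ∀ r s → binomSum r s ≤ 2 ^ r
binomSum≤2^ zero    s       = ≤-reflexive (binomSum-zeroˡ s)
binomSum≤2^ (suc r) zero    = m^n>0 2 (suc r)
binomSum≤2^ (suc r) (suc s) = begin
  binomSum (suc r) (suc s)          ≡⟨ binomSum-pascal r s ⟩
  binomSum r s + binomSum r (suc s) ≤⟨ +-mono-≤ (binomSum≤2^ r s) (binomSum≤2^ r (suc s)) ⟩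
  2 ^ r + 2 ^ r                     ≡⟨ cong (2 ^ r +_) (+-identityʳ (2 ^ r)) ⟨
  2 ^ suc r                         ∎
  where open ≤-Reasoning

<binomSum : ∀ r s .{{_ : NonZero s}} → r < binomSum r s
<binomSum r (suc zero)    = s≤s (≤-reflexive (sym (nC1≡n r)))
<binomSum r (suc (suc s)) = <-≤-trans (<binomSum r (suc s)) (m≤m+n _ _)

^-distribʳ-* : ∀ a b n → (a * b) ^ n ≡ a ^ n * b ^ n
^-distribʳ-* a b zero    = refl
^-distribʳ-* a b (suc n) =
  trans (cong ((a * b) *_) (^-distribʳ-* a b n)) (*-interchange a b (a ^ n) (b ^ n))

2^[2r+1] : ∀ r → 2 ^ (2 * r + 1) ≡ 2 * (2 ^ r * 2 ^ r)
2^[2r+1] r = begin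
  2 ^ (2 * r + 1)       ≡⟨ cong (2 ^_) (+-comm (2 * r) 1) ⟩
  2 * 2 ^ (r + (r + 0)) ≡⟨ cong (λ k → 2 * 2 ^ (r + k)) (+-identityʳ r) ⟩
  2 * 2 ^ (r + r)       ≡⟨ cong (2 *_) (^-distribˡ-+-* 2 r r) ⟩
  2 * (2 ^ r * 2 ^ r)   ∎
  where open ≡-Reasoning

r^r[2tT]^T≤[tr2^[2r+1]]^[T+1] : ∀ r t T .{{_ : NonZero r}} .{{_ : NonZero t}} → r ≤ T → T ≤ 2 ^ r →
                                r ^ r * (2 * t * T) ^ T ≤ (t * r * 2 ^ (2 * r + 1)) ^ (T + 1)
r^r[2tT]^T≤[tr2^[2r+1]]^[T+1] r t T r≤T T≤2^r = begin
  r ^ r * (2 * t * T) ^ T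
    ≤⟨ *-mono-≤ (^-monoʳ-≤ r (≤-trans r≤T (m≤m+n T 1))) (^-monoˡ-≤ T (*-monoʳ-≤ (2 * t) T≤2^r)) ⟩
  r ^ (T + 1) * (2 * t * 2 ^ r) ^ T
    ≤⟨ *-mono-≤ (^-monoˡ-≤ (T + 1) (m≤m*n r (2 ^ r))) (^-monoʳ-≤ (2 * t * 2 ^ r) (m≤m+n T 1)) ⟩
  (r * 2 ^ r) ^ (T + 1) * (2 * t * 2 ^ r) ^ (T + 1)
    ≡⟨ ^-distribʳ-* (r * 2 ^ r) (2 * t * 2 ^ r) (T + 1) ⟨
  (r * 2 ^ r * (2 * t * 2 ^ r)) ^ (T + 1)
    ≡⟨ cong (_^ (T + 1)) (trans (shuffle r t (2 ^ r)) (cong (t * r *_) (sym (2^[2r+1] r)))) ⟩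
  (t * r * 2 ^ (2 * r + 1)) ^ (T + 1) ∎
  where
  open ≤-Reasoning
  instance
    2^r≢0 : NonZero (2 ^ r)
    2^r≢0 = m^n≢0 2 r
    2t≢0 : NonZero (2 * t)
    2t≢0 = m*n≢0 2 t
    2t2^r≢0 : NonZero (2 * t * 2 ^ r)
    2t2^r≢0 = m*n≢0 (2 * t) (2 ^ r)
  shuffle : ∀ r t x → r * x * (2 * t * x) ≡ t * r * (2 * (x * x))
  shuffle = solve-∀

colouringCleaningLoss : ∀ r s t .{{_ : NonZero s}} .{{_ : NonZero r}} .{{_ : NonZero t}} {e m k} →
                        e ≤ r ^ r * m → m ≤ (2 * t * binomSum r s) ^ binomSum r s * k →
                        e ≤ (t * r * 2 ^ (2 * r + 1)) ^ (binomSum r s + 1) * k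
colouringCleaningLoss r s t {e} {m} {k} e≤ m≤ = begin
  e                                                  ≤⟨ e≤ ⟩
  r ^ r * m                                          ≤⟨ *-monoʳ-≤ (r ^ r) m≤ ⟩
  r ^ r * ((2 * t * T) ^ T * k)                      ≡⟨ *-assoc (r ^ r) _ k ⟨
  r ^ r * (2 * t * T) ^ T * k                        ≤⟨ *-monoˡ-≤ k (r^r[2tT]^T≤[tr2^[2r+1]]^[T+1] r t T (<⇒≤ (<binomSum r s)) (binomSum≤2^ r s)) ⟩
  (t * r * 2 ^ (2 * r + 1)) ^ (T + 1) * k            ∎
  where
  open ≤-Reasoning
  T : ℕ
  T = binomSum r s

d+k≰2k⇒d+k≤2d : ∀ d k → ¬ (d + k ≤ 2 * k) → d + k ≤ 2 * d
d+k≰2k⇒d+k≤2d d k ≰ = begin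
  d + k ≤⟨ +-monoʳ-≤ d (<⇒≤ k<d) ⟩
  d + d ≡⟨ cong (d +_) (+-identityʳ d) ⟨
  2 * d ∎
  where
  open ≤-Reasoning
  k<d : k < d
  k<d = +-cancelʳ-< k k d (subst (_< d + k) (cong (k +_) (+-identityʳ k)) (≰⇒> ≰))

2≤[2tu]^u : ∀ t u .{{_ : NonZero t}} .{{_ : NonZero u}} → 2 ≤ (2 * t * u) ^ u
2≤[2tu]^u t (suc u) = begin
  2                   ≤⟨ m≤m*n 2 t ⟩
  2 * t               ≤⟨ m≤m*n (2 * t) (suc u) ⟩
  2 * t * suc u       ≤⟨ m≤m*n (2 * t * suc u) ((2 * t * suc u) ^ u) ⟩
  (2 * t * suc u) ^ suc u ∎
  where
  open ≤-Reasoning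
  instance
    2t≢0 : NonZero (2 * t)
    2t≢0 = m*n≢0 2 t
    2t[1+u]≢0 : NonZero (2 * t * suc u)
    2t[1+u]≢0 = m*n≢0 (2 * t) (suc u)
    [2t[1+u]]^u≢0 : NonZero ((2 * t * suc u) ^ u)
    [2t[1+u]]^u≢0 = m^n≢0 (2 * t * suc u) u

2ut[2tu′]^u′≤[2tu]^u : ∀ t u′ u k .{{_ : NonZero t}} → u′ < u →
                        2 * (u * (t * ((2 * t * u′) ^ u′ * k))) ≤ (2 * t * u) ^ u * k
2ut[2tu′]^u′≤[2tu]^u t u′ (suc u) k (s≤s u′≤u) = begin
  2 * (suc u * (t * ((2 * t * u′) ^ u′ * k)))  ≡⟨ shuffle (suc u) t ((2 * t * u′) ^ u′) k ⟩
  2 * t * suc u * (2 * t * u′) ^ u′ * k        ≤⟨ *-monoˡ-≤ k (*-monoʳ-≤ (2 * t * suc u) (^-monoˡ-≤ u′ 2tu′≤2t[1+u])) ⟩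
  (2 * t * suc u) ^ suc u′ * k                 ≤⟨ *-monoˡ-≤ k (^-monoʳ-≤ (2 * t * suc u) (s≤s u′≤u)) ⟩
  (2 * t * suc u) ^ suc u * k                  ∎
  where
  open ≤-Reasoning
  instance
    2t≢0 : NonZero (2 * t)
    2t≢0 = m*n≢0 2 t
    2t[1+u]≢0 : NonZero (2 * t * suc u)
    2t[1+u]≢0 = m*n≢0 (2 * t) (suc u)
  2tu′≤2t[1+u] : 2 * t * u′ ≤ 2 * t * suc u
  2tu′≤2t[1+u] = *-monoʳ-≤ (2 * t) (m≤n⇒m≤1+n u′≤u)
  shuffle : ∀ u t y k → 2 * (u * (t * (y * k))) ≡ 2 * t * u * y * k
  shuffle = solve-∀

-- Rainbow colourings

module RainbowColouring {r : ℕ} .{{_ : NonZero r}} where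

  -- (F , A): the still uncoloured vertices F of an edge and the colours A already used on it.
  Residual : ℕ → Set
  Residual m = Subset m × Subset r

  Consistent : ∀ {m} → Residual m → Set
  Consistent (F , A) = ∣ F ∣ + ∣ A ∣ ≡ r

  Rainbow : ∀ {m} → (Fin m → Fin r) → Residual m → Set
  Rainbow c (F , A) = ∀ j → j ∈ₛ A ⊎ j ∈img F under c

  rainbow? : ∀ {m} (c : Fin m → Fin r) (x : Residual m) → Dec (Rainbow c x)
  rainbow? c (F , A) = all? λ j → (j ∈? A) ⊎-dec ∈img? c F j

  -- For consistent (F , A): r ^ r times the probability that a uniformly random colouring of F
  -- makes (F , A) rainbow.
  weight : ∀ {m} → Residual m → ℕ
  weight (F , A) = ∣ F ∣ ! * r ^ ∣ A ∣

  totalWeight : ∀ {m} → List (Residual m) → ℕ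
  totalWeight xs = sum (map weight xs)

  totalWeight-++ : ∀ {m} (xs ys : List (Residual m)) →
                   totalWeight (xs ++ ys) ≡ totalWeight xs + totalWeight ys
  totalWeight-++ xs ys = trans (cong sum (map-++ weight xs ys)) (sum-++ (map weight xs) (map weight ys))

  -- A residual that sees some colour twice can no longer become rainbow and is dropped.
  colourFirst : ∀ {m} → Fin r → Residual (suc m) → List (Residual m)
  colourFirst k (outside ∷ F , A) = [ F , A ]
  colourFirst k (inside ∷ F , A)  = if does (k ∈? A) then [] else [ F , ⁅ k ⁆ ∪ A ]

  restrict : ∀ {m} → Fin r → List (Residual (suc m)) → List (Residual m)
  restrict k = concatMap (colourFirst k)

  colourFirst-consistent : ∀ {m} k (x : Residual (suc m)) → Consistent x →
                           All Consistent (colourFirst k x)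
  colourFirst-consistent k (outside ∷ F , A) consistent = consistent ∷ []
  colourFirst-consistent k (inside ∷ F , A)  consistent with k ∈? A
  ... | yes _   = []
  ... | no  k∉A = trans (cong (∣ F ∣ +_) (∣⁅x⁆∪p∣≡1+∣p∣ k∉A)) (trans (+-suc ∣ F ∣ ∣ A ∣) consistent) ∷ []

  restrict-consistent : ∀ {m} k (xs : List (Residual (suc m))) → All Consistent xs →
                        All Consistent (restrict k xs)
  restrict-consistent k []       []       = []
  restrict-consistent k (x ∷ xs) (c ∷ cs) =
    AllProperties.++⁺ (colourFirst-consistent k x c) (restrict-consistent k xs cs)

  ∑-weight-colourFirst : ∀ {m} (x : Residual (suc m)) → Consistent x →
                         ∑ (λ k → totalWeight (colourFirst k x)) ≡ r * weight x
  ∑-weight-colourFirst (outside ∷ F , A) _ =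
    trans (∑-cong {r} (λ _ → +-identityʳ (weight (F , A)))) (∑-const r (weight (F , A)))
  ∑-weight-colourFirst (inside ∷ F , A) consistent = begin
    ∑ (λ k → totalWeight (colourFirst k (inside ∷ F , A))) ≡⟨ ∑-cong newColour ⟩
    ∑ (λ k → if does (k ∈? A) then 0 else b)              ≡⟨ +-cancelʳ-≡ (∣ A ∣ * b) _ _ counted ⟩
    suc ∣ F ∣ * b                                          ≡⟨ shuffle ∣ F ∣ (∣ F ∣ !) r (r ^ ∣ A ∣) ⟩
    r * weight (inside ∷ F , A)                            ∎
    where
    open ≡-Reasoning
    b : ℕ
    b = ∣ F ∣ ! * r ^ suc ∣ A ∣
    newColour : ∀ k → totalWeight (colourFirst k (inside ∷ F , A)) ≡ (if does (k ∈? A) then 0 else b)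
    newColour k with k ∈? A
    ... | yes _   = refl
    ... | no  k∉A = trans (+-identityʳ _) (cong (λ a → ∣ F ∣ ! * r ^ a) (∣⁅x⁆∪p∣≡1+∣p∣ k∉A))
    counted : ∑ (λ k → if does (k ∈? A) then 0 else b) + ∣ A ∣ * b ≡ suc ∣ F ∣ * b + ∣ A ∣ * b
    counted = trans (∑-nonmembers A b)
                    (trans (cong (_* b) (sym consistent)) (*-distribʳ-+ b (suc ∣ F ∣) ∣ A ∣))
    shuffle : ∀ f f! r x → suc f * (f! * (r * x)) ≡ r * ((f! + f * f!) * x)
    shuffle = solve-∀

  ∑-totalWeight-restrict : ∀ {m} (xs : List (Residual (suc m))) → All Consistent xs →
                           ∑ (λ k → totalWeight (restrict k xs)) ≡ r * totalWeight xs
  ∑-totalWeight-restrict []       []       = ∑-const r 0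
  ∑-totalWeight-restrict (x ∷ xs) (c ∷ cs) = begin
    ∑ (λ k → totalWeight (colourFirst k x ++ restrict k xs))
      ≡⟨ ∑-cong (λ k → totalWeight-++ (colourFirst k x) (restrict k xs)) ⟩
    ∑ (λ k → totalWeight (colourFirst k x) + totalWeight (restrict k xs))
      ≡⟨ ∑-distrib-+ {r} _ _ ⟩
    ∑ (λ k → totalWeight (colourFirst k x)) + ∑ (λ k → totalWeight (restrict k xs))
      ≡⟨ cong₂ _+_ (∑-weight-colourFirst x c) (∑-totalWeight-restrict xs cs) ⟩
    r * weight x + r * totalWeight xs
      ≡⟨ *-distribˡ-+ r (weight x) (totalWeight xs) ⟨
    r * totalWeight (x ∷ xs) ∎
    where open ≡-Reasoning

  ∈img-◂ : ∀ {m} {j} {F : Subset m} {c : Fin m → Fin r} k b →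
           j ∈img F under c → j ∈img (b ∷ F) under (k ◂ c)
  ∈img-◂ k b (v , v∈F , cv≡j) = suc v , there v∈F , cv≡j

  rainbow-colourFirst : ∀ {m} k (c : Fin m → Fin r) x →
                        count (rainbow? c) (colourFirst k x) ≤ count (rainbow? (k ◂ c)) [ x ]
  rainbow-colourFirst k c (outside ∷ F , A) =
    count-[]-mono (rainbow? c) (rainbow? (k ◂ c)) λ isRainbow j → map₂ (∈img-◂ k outside) (isRainbow j)
  rainbow-colourFirst k c (inside ∷ F , A) with k ∈? A
  ... | yes _ = z≤n
  ... | no  _ = count-[]-mono (rainbow? c) (rainbow? (k ◂ c)) λ isRainbow j → lift (isRainbow j)
    where
    lift : ∀ {j} → j ∈ₛ ⁅ k ⁆ ∪ A ⊎ j ∈img F under c → j ∈ₛ A ⊎ j ∈img (inside ∷ F) under (k ◂ c)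
    lift (inj₂ j∈cF) = inj₂ (∈img-◂ k inside j∈cF)
    lift {j} (inj₁ j∈k∪A) with x∈p∪q⁻ ⁅ k ⁆ A j∈k∪A
    ... | inj₁ j∈k = inj₂ (zero , here , sym (x∈⁅y⁆⇒x≡y k j∈k))
    ... | inj₂ j∈A = inj₁ j∈A

  rainbow-restrict : ∀ {m} k (c : Fin m → Fin r) xs →
                     count (rainbow? c) (restrict k xs) ≤ count (rainbow? (k ◂ c)) xs
  rainbow-restrict k c []       = z≤n
  rainbow-restrict k c (x ∷ xs) = begin
    count (rainbow? c) (colourFirst k x ++ restrict k xs)
      ≡⟨ count-++ (rainbow? c) (colourFirst k x) (restrict k xs) ⟩
    count (rainbow? c) (colourFirst k x) + count (rainbow? c) (restrict k xs)
      ≤⟨ +-mono-≤ (rainbow-colourFirst k c x) (rainbow-restrict k c xs) ⟩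
    count (rainbow? (k ◂ c)) [ x ] + count (rainbow? (k ◂ c)) xs
      ≡⟨ count-++ (rainbow? (k ◂ c)) [ x ] xs ⟨
    count (rainbow? (k ◂ c)) (x ∷ xs) ∎
    where open ≤-Reasoning

  totalWeight≤-fullyColoured : (xs : List (Residual 0)) → All Consistent xs →
                               totalWeight xs ≤ r ^ r * count (rainbow? (λ ())) xs
  totalWeight≤-fullyColoured []              []            = z≤n
  totalWeight≤-fullyColoured (([] , A) ∷ xs) (∣A∣≡r ∷ cs) = begin
    1 * r ^ ∣ A ∣ + totalWeight xs
      ≡⟨ cong (_+ totalWeight xs) (trans (*-identityˡ _) (cong (r ^_) ∣A∣≡r)) ⟩
    r ^ r + totalWeight xs
      ≤⟨ +-monoʳ-≤ (r ^ r) (totalWeight≤-fullyColoured xs cs) ⟩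
    r ^ r + r ^ r * count (rainbow? (λ ())) xs
      ≡⟨ *-suc (r ^ r) _ ⟨
    r ^ r * suc (count (rainbow? (λ ())) xs)
      ≡⟨ cong (λ l → r ^ r * length l) (filter-accept (rainbow? (λ ())) allSeen) ⟨
    r ^ r * count (rainbow? (λ ())) (([] , A) ∷ xs) ∎
    where
    open ≤-Reasoning
    allSeen : Rainbow (λ ()) ([] , A)
    allSeen j = inj₁ (subst (j ∈ₛ_) (sym (∣p∣≡n⇒p≡⊤ ∣A∣≡r)) ∈⊤)

  colouring : ∀ {m} (xs : List (Residual m)) → All Consistent xs →
              Σ (Fin m → Fin r) λ c → totalWeight xs ≤ r ^ r * count (rainbow? c) xs
  colouring {zero}  xs cs = (λ ()) , totalWeight≤-fullyColoured xs cs
  colouring {suc m} xs cs = k ◂ colouringAfter k , *-cancelˡ-≤ r (≤-trans averaged (proj₂ best))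
    where
    colouredAfter : ∀ k → Σ (Fin m → Fin r) λ c → totalWeight (restrict k xs) ≤ r ^ r * count (rainbow? c) (restrict k xs)
    colouredAfter k = colouring (restrict k xs) (restrict-consistent k xs cs)
    colouringAfter : Fin r → Fin m → Fin r
    colouringAfter k = proj₁ (colouredAfter k)
    gain : Fin r → ℕ
    gain k = r ^ r * count (rainbow? (k ◂ colouringAfter k)) xs
    averaged : r * totalWeight xs ≤ ∑ gain
    averaged = begin
      r * totalWeight xs                     ≡⟨ ∑-totalWeight-restrict xs cs ⟨
      ∑ (λ k → totalWeight (restrict k xs))  ≤⟨ ∑-mono-≤ (λ k → ≤-trans (proj₂ (colouredAfter k))
                                                          (*-monoʳ-≤ (r ^ r) (rainbow-restrict k (colouringAfter k) xs))) ⟩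
      ∑ gain                                 ∎
      where open ≤-Reasoning
    best : ∃ λ k → ∑ gain ≤ r * gain k
    best = ∑-pigeonhole gain
    k : Fin r
    k = proj₁ best

  length≤totalWeight : ∀ {m} (xs : List (Residual m)) → length xs ≤ totalWeight xs
  length≤totalWeight []            = z≤n
  length≤totalWeight ((F , A) ∷ xs) =
    +-mono-≤ (*-mono-≤ (1≤n! ∣ F ∣) (m^n>0 r ∣ A ∣)) (length≤totalWeight xs)

  uncoloured : ∀ {n} → Subset n → Residual n
  uncoloured F = F , ⊥

  uncoloured-consistent : ∀ {n} {E : List (Subset n)} → All (λ F → ∣ F ∣ ≡ r) E →
                          All Consistent (map uncoloured E)
  uncoloured-consistent []                    = []
  uncoloured-consistent {E = F ∷ _} (∣F∣≡r ∷ u) =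
    trans (cong (∣ F ∣ +_) (∣⊥∣≡0 r)) (trans (+-identityʳ ∣ F ∣) ∣F∣≡r) ∷ uncoloured-consistent u

  rainbow-uncoloured : ∀ {n} (c : Fin n → Fin r) → (Rainbow c ∘ uncoloured) ≐ ImageIsAll c
  rainbow-uncoloured c = (λ isRainbow j → [ ⊥-elim ∘ ∉⊥ , id ]′ (isRainbow j)) , (λ imageIsAll j → inj₂ (imageIsAll j))

  rainbowColouring : ∀ {n} (E : List (Subset n)) → All (λ F → ∣ F ∣ ≡ r) E →
                     Σ (Fin n → Fin r) λ c → length E ≤ r ^ r * count (imageIsAll? c) E
  rainbowColouring E uniform with colouring (map uncoloured E) (uncoloured-consistent uniform)
  ... | c , weight≤ = c , (begin
    length E                                         ≡⟨ length-map uncoloured E ⟨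
    length (map uncoloured E)                        ≤⟨ length≤totalWeight (map uncoloured E) ⟩
    totalWeight (map uncoloured E)                   ≤⟨ weight≤ ⟩
    r ^ r * count (rainbow? c) (map uncoloured E)    ≡⟨ cong (r ^ r *_) (count-map (rainbow? c) uncoloured E) ⟩
    r ^ r * count (rainbow? c ∘ uncoloured) E        ≡⟨ cong (λ l → r ^ r * length l) (filter-≐ _ _ (rainbow-uncoloured c) E) ⟩
    r ^ r * count (imageIsAll? c) E                  ∎)
    where open ≤-Reasoning

open RainbowColouring using (rainbowColouring)

-- Cleaning

module Cleaning {n r : ℕ} (c : Fin n → Fin r) (t : ℕ) .{{_ : NonZero t}} where

  Linked : Subset r → Subset n → Subset n → Set
  Linked e F G = ImgCapContains c F G e

  linked? : ∀ e F G → Dec (Linked e F G)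
  linked? e F G = all? λ j → (j ∈? e) →-dec any? λ v → (v ∈? F) ×-dec (v ∈? G) ×-dec (c v ≟ᶠ j)

  Linked-sym : ∀ {e F G} → Linked e F G → Linked e G F
  Linked-sym link j j∈e with link j j∈e
  ... | v , v∈F , v∈G , cv≡j = v , v∈G , v∈F , cv≡j

  degree : Subset r → Subset n → List (Subset n) → ℕ
  degree e F = count (linked? e F)

  Robust : Subset r → List (Subset n) → Set
  Robust e S = ∀ {F} → F ∈ S → t ≤ degree e F S

  Independent : Subset r → List (Subset n) → Set
  Independent e S = ∀ {F G} → F ∈ S → G ∈ S → F ≢ G → ¬ Linked e F G

  Independent-resp-⊇ : ∀ {e S S′} → (∀ {F} → F ∈ S′ → F ∈ S) →
                       Independent e S → Independent e S′
  Independent-resp-⊇ S′⊆S indep F∈S′ G∈S′ = indep (S′⊆S F∈S′) (S′⊆S G∈S′)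

  Degenerate : Subset r → List (Subset n) → Set
  Degenerate e []      = ⊤
  Degenerate e (F ∷ L) = degree e F L < t × Degenerate e L

  Degenerate-resp-⊇ : ∀ {e I L} → I ⊆ L → Degenerate e L → Degenerate e I
  Degenerate-resp-⊇ []           _              = tt
  Degenerate-resp-⊇ (_ ∷ʳ I⊆L)   (_ , degL)     = Degenerate-resp-⊇ I⊆L degL
  Degenerate-resp-⊇ (refl ∷ I⊆L) (deg<t , degL) =
    ≤-<-trans (count-⊆ (linked? _ _) I⊆L) deg<t , Degenerate-resp-⊇ I⊆L degL

  unlinked? : ∀ e F G → Dec (¬ Linked e F G)
  unlinked? e F G = ¬? (linked? e F G)

  greedyIndependent : ∀ {e} L → Acc _<_ (length L) → Degenerate e L →
                      ∃ λ I → I ⊆ L × length L ≤ t * length I × Independent e I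
  greedyIndependent []      _             _              = [] , [] , z≤n , λ ()
  greedyIndependent {e} (F ∷ L) (acc shorter) (deg<t , degL)
    with greedyIndependent (filter (unlinked? e F) L) (shorter (s≤s (length-filter (unlinked? e F) L)))
                           (Degenerate-resp-⊇ (Sublist.filter-⊆ (unlinked? e F) L) degL)
  ... | I , I⊆L′ , L′≤tI , independent =
    F ∷ I , refl ∷ ⊆-trans I⊆L′ (Sublist.filter-⊆ (unlinked? e F) L) , large , independent′
    where
    large : suc (length L) ≤ t * suc (length I)
    large = begin
      suc (length L)                                       ≡⟨ cong suc (count+count-∁≡length (linked? e F) L) ⟨
      suc (degree e F L + length (filter (unlinked? e F) L)) ≤⟨ +-mono-≤ deg<t L′≤tI ⟩
      t + t * length I                                     ≡⟨ *-suc t (length I) ⟨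
      t * suc (length I)                                   ∎
      where open ≤-Reasoning
    unlinked : ∀ {G} → G ∈ I → ¬ Linked e F G
    unlinked G∈I = proj₂ (∈-filter⁻ (unlinked? e F) {xs = L} (Sublist.Any-resp-⊆ I⊆L′ G∈I))
    independent′ : Independent e (F ∷ I)
    independent′ (here refl)  (here refl)  F≢F = ⊥-elim (F≢F refl)
    independent′ (here refl)  (there G∈I)  _   = unlinked G∈I
    independent′ (there F∈I)  (here refl)  _   = unlinked F∈I ∘ Linked-sym
    independent′ (there F∈I)  (there G∈I)      = independent F∈I G∈I

  taggedWith? : ∀ e (x : Subset n × Subset r) → Dec (proj₂ x ≡ e)
  taggedWith? e x = proj₂ x ≟ˢ e

  removedFor : Subset r → List (Subset n × Subset r) → List (Subset n)
  removedFor e D = map proj₁ (filter (taggedWith? e) D)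

  removedFor-⊆ : ∀ e D → removedFor e D ⊆ map proj₁ D
  removedFor-⊆ e D = Sublist.map⁺ proj₁ (Sublist.filter-⊆ (taggedWith? e) D)

  -- (F , e) ∈ removed: F was removed for having fewer than t e-links among the members present then.
  record Peeling (U : List (Subset r)) (S : List (Subset n)) : Set where
    field
      removed     : List (Subset n × Subset r)
      core        : List (Subset n)
      partition   : map proj₁ removed ++ core ↭ S
      removed∈U   : All (λ x → proj₂ x ∈ U) removed
      degenerate  : ∀ e → Degenerate e (removedFor e removed)
      core-robust : ∀ {e} → e ∈ U → Robust e core

  peel-∷ : ∀ {U} xs F ys {e} → e ∈ U → degree e F (xs ++ F ∷ ys) < t →
           Peeling U (xs ++ ys) → Peeling U (xs ++ F ∷ ys)
  peel-∷ {U} xs F ys {e} e∈U deg<t P = record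
    { removed     = (F , e) ∷ removed
    ; core        = core
    ; partition   = ↭-trans (↭-prep F partition) (↭-sym (shift F xs ys))
    ; removed∈U   = e∈U ∷ removed∈U
    ; degenerate  = degenerate′
    ; core-robust = core-robust
    }
    where
    open Peeling P
    fewLinks : degree e F (removedFor e removed) < t
    fewLinks = ≤-<-trans (begin
      degree e F (removedFor e removed)
        ≤⟨ count-⊆ (linked? e F) (⊆-trans (removedFor-⊆ e removed) (Sublist.++⁺ʳ core ⊆-refl)) ⟩
      degree e F (map proj₁ removed ++ core)
        ≡⟨ count-↭ (linked? e F) partition ⟩
      degree e F (xs ++ ys)
        ≤⟨ count-⊆ (linked? e F) (Sublist.++⁺ (⊆-refl {x = xs}) (F ∷ʳ ⊆-refl)) ⟩
      degree e F (xs ++ F ∷ ys) ∎) deg<t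
      where open ≤-Reasoning
    degenerate′ : ∀ e′ → Degenerate e′ (removedFor e′ ((F , e) ∷ removed))
    degenerate′ e′ with e ≟ˢ e′
    ... | yes refl = fewLinks , degenerate e
    ... | no  _    = degenerate e′

  peel : ∀ U S → Acc _<_ (length S) → Peeling U S
  peel U S (acc shorter) with anyᴸ? (λ F → anyᴸ? (λ e → degree e F S <? t) U) S
  ... | no noneWeak = record
    { removed = [] ; core = S ; partition = ↭-refl ; removed∈U = [] ; degenerate = λ _ → tt
    ; core-robust = λ e∈U F∈S → ≮⇒≥ λ deg<t → noneWeak (lose F∈S (lose e∈U deg<t)) }
  ... | yes weak with find weak
  ...   | F , F∈S , weakFor with find weakFor
  ...     | e , e∈U , deg<t with ∈-∃++ F∈S
  ...       | xs , ys , refl =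
    peel-∷ xs F ys e∈U deg<t (peel U (xs ++ ys) (shorter (≤-reflexive (sym (length-++-sucʳ xs F ys)))))

  length≤∑count-taggedWith : ∀ U D → All (λ x → proj₂ x ∈ U) D →
                             length D ≤ sum (map (λ e → count (taggedWith? e) D) U)
  length≤∑count-taggedWith []      []      _    = z≤n
  length≤∑count-taggedWith []      (_ ∷ _) (() ∷ _)
  length≤∑count-taggedWith (e ∷ U) D       tags = begin
    length D
      ≡⟨ count+count-∁≡length (taggedWith? e) D ⟨
    count (taggedWith? e) D + length others
      ≤⟨ +-monoʳ-≤ _ (length≤∑count-taggedWith U others (All.tabulate tagInU)) ⟩
    count (taggedWith? e) D + sum (map (λ e′ → count (taggedWith? e′) others) U)
      ≤⟨ +-monoʳ-≤ _ (sum-map-mono-≤ (λ e′ → count-⊆ (taggedWith? e′) (Sublist.filter-⊆ _ D)) U) ⟩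
    count (taggedWith? e) D + sum (map (λ e′ → count (taggedWith? e′) D) U) ∎
    where
    open ≤-Reasoning
    others : List (Subset n × Subset r)
    others = filter (¬? ∘ taggedWith? e) D
    tagInU : ∀ {x} → x ∈ others → proj₂ x ∈ U
    tagInU x∈others with ∈-filter⁻ (¬? ∘ taggedWith? e) {xs = D} x∈others
    ... | x∈D , notE with All.lookup tags x∈D
    ...   | here  tag≡e = ⊥-elim (notE tag≡e)
    ...   | there tag∈U = tag∈U

  popularTag : ∀ e₀ U₀ D → All (λ x → proj₂ x ∈ e₀ ∷ U₀) D →
               ∃ λ e → e ∈ e₀ ∷ U₀ × length D ≤ length (e₀ ∷ U₀) * length (removedFor e D)
  popularTag e₀ U₀ D tags
    with pigeonhole (count (taggedWith? e₀) D) (map (λ e → count (taggedWith? e) D) U₀)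
  ... | y , y∈ , ∑≤ with ∈-map⁻ (λ e → count (taggedWith? e) D) {xs = e₀ ∷ U₀} y∈
  ...   | e , e∈U , refl = e , e∈U , (begin
    length D
      ≤⟨ length≤∑count-taggedWith (e₀ ∷ U₀) D tags ⟩
    sum (map (λ e → count (taggedWith? e) D) (e₀ ∷ U₀))
      ≤⟨ ∑≤ ⟩
    length (map (λ e → count (taggedWith? e) D) (e₀ ∷ U₀)) * count (taggedWith? e) D
      ≡⟨ cong₂ _*_ (length-map _ (e₀ ∷ U₀)) (sym (length-map proj₁ (filter (taggedWith? e) D))) ⟩
    length (e₀ ∷ U₀) * length (removedFor e D) ∎)
    where open ≤-Reasoning

  -- The family may contain F itself.
  linkedFamily : ∀ {e S F} → Unique S → Robust e S → F ∈ S →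
                 Σ (Fin t → Subset n) λ Fs →
                   Injective _≡_ _≡_ Fs × (∀ i → Fs i ∈ S) × (∀ i → Linked e F (Fs i))
  linkedFamily {e} {S} {F} uniqueS robustS F∈S
    with Fin-embedding (Unique.filter⁺ (linked? e F) uniqueS) (robustS F∈S)
  ... | Fs , injective , Fs∈ = Fs , injective , proj₁ ∘ linkedMember ∘ Fs∈ , proj₂ ∘ linkedMember ∘ Fs∈
    where
    linkedMember : ∀ {G} → G ∈ filter (linked? e F) S → G ∈ S × Linked e F G
    linkedMember = ∈-filter⁻ (linked? e F) {xs = S}

  record Cleaned (U : List (Subset r)) (S : List (Subset n)) : Set where
    field
      kept        : List (Subset n)
      unique      : Unique kept
      kept⊆S      : ∀ {F} → F ∈ kept → F ∈ S
      large       : length S ≤ (2 * t * length U) ^ length U * length kept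
      robustTypes : List (Subset r)
      robust      : ∀ {e} → e ∈ robustTypes → Robust e kept
      independent : ∀ {e} → e ∈ U → e ∉ robustTypes → Independent e kept

  module _ {e₀ U₀ S} (uniqueS : Unique S) (P : Peeling (e₀ ∷ U₀) S) where
    open Peeling P

    length-partition : length S ≡ length removed + length core
    length-partition = begin
      length S                                 ≡⟨ ↭-length partition ⟨
      length (map proj₁ removed ++ core)       ≡⟨ length-++ (map proj₁ removed) ⟩
      length (map proj₁ removed) + length core ≡⟨ cong (_+ length core) (length-map proj₁ removed) ⟩
      length removed + length core             ∎
      where open ≡-Reasoning

    unique-partition : Unique (map proj₁ removed ++ core)
    unique-partition = Unique-resp-↭ (↭-sym partition) uniqueS

    keepCore : length S ≤ 2 * length core → Cleaned (e₀ ∷ U₀) S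
    keepCore coreLarge = record
      { kept        = core
      ; unique      = Unique-resp-⊇ (Sublist.++⁺ˡ (map proj₁ removed) ⊆-refl) unique-partition
      ; kept⊆S      = ∈-resp-↭ partition ∘ ∈-++⁺ʳ (map proj₁ removed)
      ; large       = ≤-trans coreLarge (*-monoˡ-≤ (length core) (2≤[2tu]^u t (length (e₀ ∷ U₀))))
      ; robustTypes = e₀ ∷ U₀
      ; robust      = core-robust
      ; independent = λ e∈U e∉U → ⊥-elim (e∉U e∈U)
      }

    keepIndependent : ¬ (length S ≤ 2 * length core) →
                      (∀ U′ → length U′ < length (e₀ ∷ U₀) → ∀ S′ → Unique S′ → Cleaned U′ S′) →
                      Cleaned (e₀ ∷ U₀) S
    keepIndependent coreSmall cleanSmaller with popularTag e₀ U₀ removed removed∈U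
    ... | e , e∈U , popular with greedyIndependent (removedFor e removed) (<-wellFounded _) (degenerate e)
    ...   | I , I⊆removed , I-large , I-independent = record
      { kept        = kept
      ; unique      = unique
      ; kept⊆S      = I⊆S ∘ kept⊆S
      ; large       = large′
      ; robustTypes = robustTypes
      ; robust      = robust
      ; independent = independent′
      }
      where
      U : List (Subset r)
      U = e₀ ∷ U₀
      I⊆partition : I ⊆ map proj₁ removed ++ core
      I⊆partition = ⊆-trans I⊆removed (⊆-trans (removedFor-⊆ e removed) (Sublist.++⁺ʳ core ⊆-refl))
      I⊆S : ∀ {F} → F ∈ I → F ∈ S
      I⊆S = ∈-resp-↭ partition ∘ Sublist.Any-resp-⊆ I⊆partition
      U′ : List (Subset r)
      U′ = filter (λ e′ → ¬? (e′ ≟ˢ e)) U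
      U′-shorter : length U′ < length U
      U′-shorter = filter-notAll (λ e′ → ¬? (e′ ≟ˢ e)) U (lose e∈U λ e≢e → e≢e refl)
      open Cleaned (cleanSmaller U′ U′-shorter I (Unique-resp-⊇ I⊆partition unique-partition))
      large′ : length S ≤ (2 * t * length U) ^ length U * length kept
      large′ = begin
        length S
          ≡⟨ length-partition ⟩
        length removed + length core
          ≤⟨ d+k≰2k⇒d+k≤2d (length removed) (length core) (subst (λ l → ¬ (l ≤ 2 * length core)) length-partition coreSmall) ⟩
        2 * length removed
          ≤⟨ *-monoʳ-≤ 2 popular ⟩
        2 * (length U * length (removedFor e removed))
          ≤⟨ *-monoʳ-≤ 2 (*-monoʳ-≤ (length U) (≤-trans I-large (*-monoʳ-≤ t large))) ⟩
        2 * (length U * (t * ((2 * t * length U′) ^ length U′ * length kept)))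
          ≤⟨ 2ut[2tu′]^u′≤[2tu]^u t (length U′) (length U) (length kept) U′-shorter ⟩
        (2 * t * length U) ^ length U * length kept ∎
        where open ≤-Reasoning
      independent′ : ∀ {e′} → e′ ∈ U → e′ ∉ robustTypes → Independent e′ kept
      independent′ {e′} e′∈U e′∉robust with e′ ≟ˢ e
      ... | yes refl = Independent-resp-⊇ kept⊆S I-independent
      ... | no  e′≢e = independent (∈-filter⁺ (λ e″ → ¬? (e″ ≟ˢ e)) e′∈U e′≢e) e′∉robust

  cleanAcc : ∀ U → Acc _<_ (length U) → ∀ S → Unique S → Cleaned U S
  cleanAcc [] _ S uniqueS = record
    { kept = S ; unique = uniqueS ; kept⊆S = id ; large = ≤-reflexive (sym (+-identityʳ (length S)))
    ; robustTypes = [] ; robust = λ () ; independent = λ () }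
  cleanAcc U@(_ ∷ _) (acc smaller) S uniqueS with peel U S (<-wellFounded _)
  ... | P with length S ≤? 2 * length (Peeling.core P)
  ...   | yes coreLarge = keepCore uniqueS P coreLarge
  ...   | no  coreSmall = keepIndependent uniqueS P coreSmall λ U′ shorter → cleanAcc U′ (smaller shorter)

  clean : ∀ U S → Unique S → Cleaned U S
  clean U = cleanAcc U (<-wellFounded (length U))

theorem3p9 : (s r t : ℕ) → .{{NonZero s}} → .{{NonZero r}} → .{{NonZero t}} →
    (n : ℕ) → (𝓕 : UniformHypergraph n r) →
    Σ (List (Subset n)) λ Estar → Σ (Fin n → Fin r) λ c →
      Unique Estar ×
      All (λ F → F ∈ UniformHypergraph.edges 𝓕) Estar ×
      (length (UniformHypergraph.edges 𝓕)
        ≤ (t * r * 2 ^ (2 * r + 1)) ^ (binomSum r s + 1) * length Estar) ×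
      All (ImageIsAll c) Estar ×
      (Σ (Subset r → Bool) λ H → HasEdgesAtMost s H ×
        ((e : Subset r) → ∣ e ∣ ≤ s →
          (H e ≡ true →
            ∀ F → F ∈ Estar →
              Σ (Fin t → Subset n) λ Fs → Injective _≡_ _≡_ Fs ×
                (∀ i → Fs i ∈ Estar) × (∀ i → ImgCapContains c F (Fs i) e)) ×
          (¬ (H e ≡ true) →
            ∀ F F′ → F ∈ Estar → F′ ∈ Estar → F ≢ F′ →
              ¬ ImgCapContains c F F′ e)))
theorem3p9 s r t n 𝓕 with rainbowColouring (UniformHypergraph.edges 𝓕) (UniformHypergraph.uniform 𝓕)
... | c , colouringBound =
  kept , c , unique , All.tabulate (proj₁ ∘ rainbow ∘ kept⊆S) , bound , All.tabulate (proj₂ ∘ rainbow ∘ kept⊆S) ,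
  H , (λ _ → proj₂ ∘ edgeOfH) ,
  λ e ∣e∣≤s → (λ isEdge _ → linkedFamily unique (robust (proj₁ (edgeOfH isEdge)))) ,
              (λ notEdge _ _ → independent (∈-subsetsOfSize≤ e ∣e∣≤s) (notEdge ∘ Equivalence.to T-≡ ∘ fromWitness ∘ (_, ∣e∣≤s)))
  where
  E : List (Subset n)
  E = UniformHypergraph.edges 𝓕
  rainbow : ∀ {F} → F ∈ filter (imageIsAll? c) E → F ∈ E × ImageIsAll c F
  rainbow = ∈-filter⁻ (imageIsAll? c) {xs = E}
  open Cleaning c t
  open Cleaned (clean (subsetsOfSize≤ r s) (filter (imageIsAll? c) E) (Unique.filter⁺ (imageIsAll? c) (UniformHypergraph.unique 𝓕)))
  open DecMembership (_≟ˢ_ {r}) using () renaming (_∈?_ to _∈ᴸ?_)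
  -- The size condition is redundant (robust types have size at most s) but gives HasEdgesAtMost at once.
  H? : ∀ e → Dec (e ∈ robustTypes × ∣ e ∣ ≤ s)
  H? e = (e ∈ᴸ? robustTypes) ×-dec (∣ e ∣ ≤? s)
  H : Subset r → Bool
  H e = isYes (H? e)
  edgeOfH : ∀ {e} → H e ≡ true → e ∈ robustTypes × ∣ e ∣ ≤ s
  edgeOfH {e} = toWitness {a? = H? e} ∘ Equivalence.from T-≡
  bound : length E ≤ (t * r * 2 ^ (2 * r + 1)) ^ (binomSum r s + 1) * length kept
  bound = colouringCleaningLoss r s t colouringBound
            (subst (λ l → _ ≤ (2 * t * l) ^ l * length kept) (length-subsetsOfSize≤ r s) large)
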